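{- Let $n\ge 3$ and let $n>n_1>n_2>\cdots>n_r>0$ be integers. Let $DC_n^{n_1,\ldots,n_r}$ be the digraph on vertex set $\{1,2,\ldots,n\}$ whose arcs are $(t,t+1)$ for $1\le t\le n-1$, the arc $(n,1)$, and the arcs $(n,n_t+1)$ for $t=1,\ldots,r$. Then $$\Psi_{DC_n^{n_1,\ldots,n_r}}(x)=x^n-\sum_{t=1}^{r}x^{n_t}-1.$$
   Context: The characteristic polynomial $\Psi_X(x)$ of a digraph $X$ is $\det(xI-A)$, where $A$ is the adjacency matrix of $X$ (the $(i,j)$ entry is the number of arcs from $i$ to $j$). -}

module Defs where

open import Data.Nat as ℕ using (ℕ; zero; suc; _<_; _>_)
open import Data.Nat.Properties using () renaming (_≟_ to _≟ℕ_)
open import Data.Integer as ℤ using (ℤ; +_)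
open import Data.Fin using (Fin; zero; suc; toℕ; punchIn)
open import Data.List using (List; []; _∷_; map; upTo; _++_; replicate)
open import Data.Product using (_×_; _,_)
open import Relation.Nullary using (yes; no)
open import Relation.Binary.PropositionalEquality using (_≡_)

-- Polynomials over ℤ : coefficient lists, lowest degree first.

Poly : Set
Poly = List ℤ

infixl 6 _+ₚ_ _-ₚ_
infixl 7 _*ₚ_

_+ₚ_ : Poly → Poly → Poly
[] +ₚ q = q
(a ∷ p) +ₚ [] = a ∷ p
(a ∷ p) +ₚ (b ∷ q) = (a ℤ.+ b) ∷ (p +ₚ q)

negₚ : Poly → Poly
negₚ = map (λ a → ℤ.- a)

_-ₚ_ : Poly → Poly → Poly
p -ₚ q = p +ₚ negₚ q

_*ₚ_ : Poly → Poly → Poly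
[] *ₚ q = []
(a ∷ p) *ₚ q = map (a ℤ.*_) q +ₚ ((+ 0) ∷ (p *ₚ q))

constₚ : ℤ → Poly
constₚ a = a ∷ []

Xpow : ℕ → Poly
Xpow k = replicate k (+ 0) ++ (+ 1 ∷ [])

coeff : Poly → ℕ → ℤ
coeff [] k = + 0
coeff (a ∷ p) zero = a
coeff (a ∷ p) (suc k) = coeff p k

infix 4 _≈ₚ_
_≈ₚ_ : Poly → Poly → Set
p ≈ₚ q = ∀ k → coeff p k ≡ coeff q k

sumₚ : List Poly → Poly
sumₚ [] = []
sumₚ (p ∷ ps) = p +ₚ sumₚ ps

signₚ : ℕ → Poly → Poly
signₚ zero p = p
signₚ (suc k) p = negₚ (signₚ k p)

ΣFin : ∀ {n} → (Fin n → Poly) → Poly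
ΣFin {zero} f = []
ΣFin {suc n} f = f zero +ₚ ΣFin (λ i → f (suc i))

det : ∀ n → (Fin n → Fin n → Poly) → Poly
det zero M = constₚ (+ 1)
det (suc n) M =
  ΣFin (λ j → signₚ (toℕ j) (M zero j *ₚ det n (λ i k → M (suc i) (punchIn j k))))

-- Digraphs on vertex set {1,…,n} given by a list of arcs (multi-arcs allowed).

count : (ℕ × ℕ) → List (ℕ × ℕ) → ℕ
count e [] = 0
count (a , b) ((c , d) ∷ es) with a ≟ℕ c | b ≟ℕ d
... | yes _ | yes _ = suc (count (a , b) es)
... | _     | _     = count (a , b) es

-- adjacency matrix: (i,j) entry = number of arcs from vertex i+1 to vertex j+1
adj : (n : ℕ) → List (ℕ × ℕ) → Fin n → Fin n → ℕ
adj n arcs i j = count (suc (toℕ i) , suc (toℕ j)) arcs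

δ : ∀ {n} → Fin n → Fin n → ℤ
δ i j with toℕ i ≟ℕ toℕ j
... | yes _ = + 1
... | no _  = + 0

charPoly : (n : ℕ) → List (ℕ × ℕ) → Poly
charPoly n arcs =
  det n (λ i j → (constₚ (δ i j) *ₚ Xpow 1) -ₚ constₚ (+ (adj n arcs i j)))

DCarcs : ℕ → List ℕ → List (ℕ × ℕ)
DCarcs n ns =
  map (λ t → (suc t , suc (suc t))) (upTo (n ℕ.∸ 1))
  ++ ((n , 1) ∷ map (λ m → (n , suc m)) ns)

module Submission where

-- Write n = s + 1.  In xI - A for DC_n^{n_1,…,n_r} every row r < s (vertex
-- r+1 < n) has x on the diagonal, -1 immediately to its right and 0 elsewhere,
-- since the only arc leaving vertex r+1 is (r+1, r+2).  The last row (vertex n)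
-- is (-a_0, …, -a_{s-1}, x - a_s), where a_k is the number of arcs from n to
-- k+1, i.e. the coefficient of x^k in 1 + Σ_t x^{n_t}.  Such a companion matrix
-- of a row v has determinant v_0 + x (v_1 + x (… + x v_s)) (Horner's scheme),
-- which here equals x^n - Σ_t x^{n_t} - 1.

open import Defs
open import Data.Nat as ℕ using (ℕ; zero; suc; _<_; _>_; _≤_; z≤n; s≤s)
open import Data.Nat.Properties as ℕP using () renaming (_≟_ to _≟ℕ_)
open import Data.Integer as ℤ using (ℤ; +_)
import Data.Integer.Properties as ℤP
open import Data.Integer.Tactic.RingSolver using (solve-∀)
open import Data.Fin using (Fin; zero; suc; toℕ; fromℕ; punchIn)
open import Data.Fin.Properties using (toℕ-fromℕ)
open import Data.List using (List; []; _∷_; map; _++_; upTo; [_])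
open import Data.List.Properties using (map-++; upTo-∷ʳ)
open import Data.List.Relation.Unary.All as All using (All; []; _∷_)
open import Data.List.Relation.Unary.All.Properties using (all-upTo)
open import Data.List.Relation.Unary.Linked using (Linked)
open import Data.Product using (_×_; _,_; proj₁; proj₂)
open import Data.Empty using (⊥-elim)
open import Relation.Nullary using (Dec; yes; no)
open import Relation.Binary.Bundles using (Setoid)
import Relation.Binary.Reasoning.Setoid
open import Level using (0ℓ)
open import Relation.Binary.PropositionalEquality hiding ([_])

-- (1) Coefficient calculus for list polynomials.

-- p ≈ₚ q unfolds to a Π-type from which Agda cannot recover p and q, so
-- structural reasoning uses the record _≋_, the same relation with its two
-- polynomials visible to type inference.
infix 4 _≋_
record _≋_ (p q : Poly) : Set where
  constructor coeffwise
  field at : p ≈ₚ q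
open _≋_

≋-refl : ∀ {p} → p ≋ p
≋-refl = coeffwise (λ _ → refl)

≋-sym : ∀ {p q} → p ≋ q → q ≋ p
≋-sym e = coeffwise (λ k → sym (at e k))

≋-trans : ∀ {p q r} → p ≋ q → q ≋ r → p ≋ r
≋-trans e f = coeffwise (λ k → trans (at e k) (at f k))

≡⇒≋ : ∀ {p q} → p ≡ q → p ≋ q
≡⇒≋ refl = ≋-refl

≋-setoid : Setoid 0ℓ 0ℓ
≋-setoid = record
  { Carrier = Poly ; _≈_ = _≋_
  ; isEquivalence = record { refl = ≋-refl ; sym = ≋-sym ; trans = ≋-trans } }

module ≋-Reasoning = Relation.Binary.Reasoning.Setoid ≋-setoid

coeff-+ : ∀ p q k → coeff (p +ₚ q) k ≡ coeff p k ℤ.+ coeff q k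
coeff-+ [] q k = sym (ℤP.+-identityˡ _)
coeff-+ (a ∷ p) [] k = sym (ℤP.+-identityʳ _)
coeff-+ (a ∷ p) (b ∷ q) zero = refl
coeff-+ (a ∷ p) (b ∷ q) (suc k) = coeff-+ p q k

coeff-neg : ∀ p k → coeff (negₚ p) k ≡ ℤ.- coeff p k
coeff-neg [] k = refl
coeff-neg (a ∷ p) zero = refl
coeff-neg (a ∷ p) (suc k) = coeff-neg p k

coeff-- : ∀ p q k → coeff (p -ₚ q) k ≡ coeff p k ℤ.- coeff q k
coeff-- p q k = trans (coeff-+ p (negₚ q) k) (cong (λ z → coeff p k ℤ.+ z) (coeff-neg q k))

coeff-scale : ∀ a q k → coeff (map (a ℤ.*_) q) k ≡ a ℤ.* coeff q k
coeff-scale a [] k = sym (ℤP.*-zeroʳ a)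
coeff-scale a (b ∷ q) zero = refl
coeff-scale a (b ∷ q) (suc k) = coeff-scale a q k

-- Dropping the constant term; it lets products be analysed without case
-- distinctions on the shape of the coefficient lists.
tailₚ : Poly → Poly
tailₚ [] = []
tailₚ (a ∷ p) = p

coeff-tail : ∀ p k → coeff (tailₚ p) k ≡ coeff p (suc k)
coeff-tail [] k = refl
coeff-tail (a ∷ p) k = refl

coeff-*-zero : ∀ p q → coeff (p *ₚ q) 0 ≡ coeff p 0 ℤ.* coeff q 0
coeff-*-zero [] q = sym (ℤP.*-zeroˡ (coeff q 0))
coeff-*-zero (a ∷ p) q =
  trans (coeff-+ (map (a ℤ.*_) q) (+ 0 ∷ (p *ₚ q)) 0)
        (trans (ℤP.+-identityʳ _) (coeff-scale a q 0))

coeff-*-suc : ∀ p q k →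
  coeff (p *ₚ q) (suc k) ≡ coeff p 0 ℤ.* coeff q (suc k) ℤ.+ coeff (tailₚ p *ₚ q) k
coeff-*-suc [] q k = sym (trans (ℤP.+-identityʳ _) (ℤP.*-zeroˡ (coeff q (suc k))))
coeff-*-suc (a ∷ p) q k =
  trans (coeff-+ (map (a ℤ.*_) q) (+ 0 ∷ (p *ₚ q)) (suc k))
        (cong (ℤ._+ coeff (p *ₚ q) k) (coeff-scale a q (suc k)))

coeff-const* : ∀ a q k → coeff (constₚ a *ₚ q) k ≡ a ℤ.* coeff q k
coeff-const* a q zero = coeff-*-zero (constₚ a) q
coeff-const* a q (suc k) = trans (coeff-*-suc (constₚ a) q k) (ℤP.+-identityʳ _)

X : Poly
X = Xpow 1

minusOne : Poly
minusOne = constₚ (ℤ.- (+ 1))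

coeff-X*-zero : ∀ q → coeff (X *ₚ q) 0 ≡ + 0
coeff-X*-zero q = trans (coeff-*-zero X q) (ℤP.*-zeroˡ (coeff q 0))

coeff-X*-suc : ∀ q k → coeff (X *ₚ q) (suc k) ≡ coeff q k
coeff-X*-suc q k = begin
  coeff (X *ₚ q) (suc k)                            ≡⟨ coeff-*-suc X q k ⟩
  + 0 ℤ.* coeff q (suc k) ℤ.+ coeff (constₚ (+ 1) *ₚ q) k
    ≡⟨ cong₂ ℤ._+_ (ℤP.*-zeroˡ (coeff q (suc k))) (coeff-const* (+ 1) q k) ⟩
  + 0 ℤ.+ + 1 ℤ.* coeff q k                         ≡⟨ ℤP.+-identityˡ _ ⟩
  + 1 ℤ.* coeff q k                                 ≡⟨ ℤP.*-identityˡ _ ⟩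
  coeff q k                                         ∎
  where open ≡-Reasoning

*-one : ∀ p → p *ₚ constₚ (+ 1) ≋ p
*-one p = coeffwise (coeffs p)
  where
  open ≡-Reasoning
  coeffs : ∀ p k → coeff (p *ₚ constₚ (+ 1)) k ≡ coeff p k
  coeffs p zero = trans (coeff-*-zero p (constₚ (+ 1))) (ℤP.*-identityʳ _)
  coeffs p (suc k) = begin
    coeff (p *ₚ constₚ (+ 1)) (suc k)                         ≡⟨ coeff-*-suc p (constₚ (+ 1)) k ⟩
    coeff p 0 ℤ.* + 0 ℤ.+ coeff (tailₚ p *ₚ constₚ (+ 1)) k
      ≡⟨ cong₂ ℤ._+_ (ℤP.*-zeroʳ (coeff p 0)) (coeffs (tailₚ p) k) ⟩
    + 0 ℤ.+ coeff (tailₚ p) k                                 ≡⟨ ℤP.+-identityˡ _ ⟩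
    coeff (tailₚ p) k                                         ≡⟨ coeff-tail p k ⟩
    coeff p (suc k)                                           ∎

+-identityʳₚ : ∀ p → p +ₚ [] ≋ p
+-identityʳₚ [] = ≋-refl
+-identityʳₚ (a ∷ p) = ≋-refl

constₚ-zero : constₚ (+ 0) ≋ []
constₚ-zero = coeffwise λ { zero → refl ; (suc k) → refl }

sub-minusOne* : ∀ p q → p -ₚ (minusOne *ₚ q) ≋ p +ₚ q
sub-minusOne* p q = coeffwise λ k → begin
  coeff (p -ₚ (minusOne *ₚ q)) k            ≡⟨ coeff-- p _ k ⟩
  coeff p k ℤ.- coeff (minusOne *ₚ q) k     ≡⟨ cong (λ z → coeff p k ℤ.- z) (coeff-const* (ℤ.- (+ 1)) q k) ⟩
  coeff p k ℤ.- (ℤ.- (+ 1) ℤ.* coeff q k)   ≡⟨ cong (λ z → coeff p k ℤ.- z) (ℤP.-1*i≡-i _) ⟩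
  coeff p k ℤ.- ℤ.- coeff q k               ≡⟨ cong (λ z → coeff p k ℤ.+ z) (ℤP.neg-involutive _) ⟩
  coeff p k ℤ.+ coeff q k                   ≡⟨ coeff-+ p q k ⟨
  coeff (p +ₚ q) k                          ∎
  where open ≡-Reasoning

coeff-Xpow-same : ∀ m → coeff (Xpow m) m ≡ + 1
coeff-Xpow-same zero = refl
coeff-Xpow-same (suc m) = coeff-Xpow-same m

coeff-Xpow-other : ∀ m k → k ≢ m → coeff (Xpow m) k ≡ + 0
coeff-Xpow-other zero zero k≢m = ⊥-elim (k≢m refl)
coeff-Xpow-other zero (suc k) k≢m = refl
coeff-Xpow-other (suc m) zero k≢m = refl
coeff-Xpow-other (suc m) (suc k) k≢m = coeff-Xpow-other m k (λ e → k≢m (cong suc e))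

coeff-sumXpow-above : ∀ ms k → All (_< k) ms → coeff (sumₚ (map Xpow ms)) k ≡ + 0
coeff-sumXpow-above [] k [] = refl
coeff-sumXpow-above (m ∷ ms) k (m<k ∷ ms<k) = begin
  coeff (Xpow m +ₚ sumₚ (map Xpow ms)) k                 ≡⟨ coeff-+ (Xpow m) _ k ⟩
  coeff (Xpow m) k ℤ.+ coeff (sumₚ (map Xpow ms)) k
    ≡⟨ cong₂ ℤ._+_ (coeff-Xpow-other m k (λ k≡m → ℕP.<-irrefl (sym k≡m) m<k))
                   (coeff-sumXpow-above ms k ms<k) ⟩
  + 0                                                     ∎
  where open ≡-Reasoning

-- Congruences of the polynomial operations; the one-sided versions take the
-- fixed factor explicitly since it cannot be recovered from a sum or product.
+-cong : ∀ {p p' q q'} → p ≋ p' → q ≋ q' → p +ₚ q ≋ p' +ₚ q'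
+-cong {p} {p'} {q} {q'} e f = coeffwise λ k →
  trans (coeff-+ p q k) (trans (cong₂ ℤ._+_ (at e k) (at f k)) (sym (coeff-+ p' q' k)))

neg-cong : ∀ {p p'} → p ≋ p' → negₚ p ≋ negₚ p'
neg-cong {p} {p'} e = coeffwise λ k →
  trans (coeff-neg p k) (trans (cong ℤ.-_ (at e k)) (sym (coeff-neg p' k)))

sign-cong : ∀ m {p p'} → p ≋ p' → signₚ m p ≋ signₚ m p'
sign-cong zero e = e
sign-cong (suc m) e = neg-cong (sign-cong m e)

+-congˡ : ∀ p {q q'} → q ≋ q' → p +ₚ q ≋ p +ₚ q'
+-congˡ p = +-cong (≋-refl {p})

tail-cong : ∀ {p p'} → p ≋ p' → tailₚ p ≋ tailₚ p'
tail-cong {p} {p'} e = coeffwise λ k →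
  trans (coeff-tail p k) (trans (at e (suc k)) (sym (coeff-tail p' k)))

*-cong : ∀ {p p' q q'} → p ≋ p' → q ≋ q' → p *ₚ q ≋ p' *ₚ q'
*-cong {q = q} {q' = q'} e f = coeffwise (λ k → coeffs k e)
  where
  coeffs : ∀ k {p p'} → p ≋ p' → coeff (p *ₚ q) k ≡ coeff (p' *ₚ q') k
  coeffs zero {p} {p'} e =
    trans (coeff-*-zero p q) (trans (cong₂ ℤ._*_ (at e 0) (at f 0)) (sym (coeff-*-zero p' q')))
  coeffs (suc k) {p} {p'} e =
    trans (coeff-*-suc p q k)
          (trans (cong₂ ℤ._+_ (cong₂ ℤ._*_ (at e 0) (at f (suc k))) (coeffs k (tail-cong e)))
                 (sym (coeff-*-suc p' q' k)))

*-congˡ : ∀ p {q q'} → q ≋ q' → p *ₚ q ≋ p *ₚ q'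
*-congˡ p = *-cong (≋-refl {p})

*-congʳ : ∀ q {p p'} → p ≋ p' → p *ₚ q ≋ p' *ₚ q
*-congʳ q e = *-cong e (≋-refl {q})

-- (2) Determinants: congruence and a two-entry Laplace expansion.

ΣFin-cong : ∀ {n} {f g : Fin n → Poly} → (∀ i → f i ≋ g i) → ΣFin f ≋ ΣFin g
ΣFin-cong {zero} e = ≋-refl
ΣFin-cong {suc n} e = +-cong (e zero) (ΣFin-cong (λ i → e (suc i)))

ΣFin-zero : ∀ {n} {f : Fin n → Poly} → (∀ i → f i ≋ []) → ΣFin f ≋ []
ΣFin-zero {zero} e = ≋-refl
ΣFin-zero {suc n} e = +-cong (e zero) (ΣFin-zero (λ i → e (suc i)))

sign-[] : ∀ m → signₚ m [] ≋ []
sign-[] zero = ≋-refl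
sign-[] (suc m) = neg-cong (sign-[] m)

minor : ∀ {n} → Fin (suc n) → (Fin (suc n) → Fin (suc n) → Poly) → Fin n → Fin n → Poly
minor j M i k = M (suc i) (punchIn j k)

det-cong : ∀ n {M M' : Fin n → Fin n → Poly} → (∀ i j → M i j ≋ M' i j) → det n M ≋ det n M'
det-cong zero e = ≋-refl
det-cong (suc n) e =
  ΣFin-cong (λ j → sign-cong (toℕ j) (*-cong (e zero j) (det-cong n (λ i k → e (suc i) (punchIn j k)))))

det-twoEntryRow : ∀ s (M : Fin (suc (suc s)) → Fin (suc (suc s)) → Poly) →
  (∀ j → M zero (suc (suc j)) ≋ []) →
  det (suc (suc s)) M ≋
    (M zero zero *ₚ det (suc s) (minor zero M)) -ₚ (M zero (suc zero) *ₚ det (suc s) (minor (suc zero) M))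
det-twoEntryRow s M row₀ = +-congˡ term₀ (≋-trans (+-congˡ (negₚ term₁) laterTerms) (+-identityʳₚ (negₚ term₁)))
  where
  term₀ = M zero zero *ₚ det (suc s) (minor zero M)
  term₁ = M zero (suc zero) *ₚ det (suc s) (minor (suc zero) M)
  laterTerms : ΣFin (λ j → signₚ (toℕ (suc (suc j))) (M zero (suc (suc j)) *ₚ det (suc s) (minor (suc (suc j)) M))) ≋ []
  laterTerms = ΣFin-zero (λ j → ≋-trans (sign-cong (suc (suc (toℕ j)))
                                           (*-congʳ (det (suc s) (minor (suc (suc j)) M)) (row₀ j)))
                                        (sign-[] (suc (suc (toℕ j)))))

-- (3) Companion matrices and their Horner determinant.

firstRow : Poly → Poly → ∀ {s} → Fin (suc (suc s)) → Poly
firstRow a c zero = a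
firstRow a c (suc zero) = c
firstRow a c (suc (suc _)) = []

lastOnly : ∀ {s} → Fin (suc s) → Poly → Poly
lastOnly {zero} zero p = p
lastOnly {suc s} zero p = []
lastOnly {suc s} (suc i) p = lastOnly i p

-- The (s+1)×(s+1) matrix with first row (a, c, 0, …, 0), last row v, and in
-- between x on the diagonal, -1 on the superdiagonal and 0 elsewhere.  The
-- first row is kept general because deleting the first row and column 0 or 1
-- of such a matrix gives again a matrix of this form.
bordered : (s : ℕ) → Poly → Poly → (Fin (suc s) → Poly) → Fin (suc s) → Fin (suc s) → Poly
bordered zero a c v i j = v j
bordered (suc s) a c v zero j = firstRow a c j
bordered (suc s) a c v (suc i) zero = lastOnly i (v zero)
bordered (suc s) a c v (suc i) (suc k) = bordered s X minusOne (λ j → v (suc j)) i k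

companion : (s : ℕ) → (Fin (suc s) → Poly) → Fin (suc s) → Fin (suc s) → Poly
companion s v = bordered s X minusOne v

minor₁-bordered : ∀ s a c v i k →
  minor (suc zero) (bordered (suc s) a c v) i k ≡ bordered s [] minusOne (λ j → v (punchIn (suc zero) j)) i k
minor₁-bordered zero a c v zero zero = refl
minor₁-bordered zero a c v zero (suc k) = refl
minor₁-bordered (suc s) a c v zero zero = refl
minor₁-bordered (suc s) a c v zero (suc zero) = refl
minor₁-bordered (suc s) a c v zero (suc (suc k)) = refl
minor₁-bordered (suc s) a c v (suc i) zero = refl
minor₁-bordered (suc s) a c v (suc i) (suc k) = refl

det-bordered-base : ∀ a c v → det 1 (bordered zero a c v) ≋ v zero
det-bordered-base a c v = ≋-trans (+-identityʳₚ (v zero *ₚ constₚ (+ 1))) (*-one (v zero))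

det-bordered-step : ∀ s a c v →
  det (suc (suc s)) (bordered (suc s) a c v) ≋
    (a *ₚ det (suc s) (companion s (λ j → v (suc j))))
      -ₚ (c *ₚ det (suc s) (bordered s [] minusOne (λ j → v (punchIn (suc zero) j))))
det-bordered-step s a c v =
  ≋-trans (det-twoEntryRow s (bordered (suc s) a c v) (λ j → ≋-refl))
          (+-congˡ (a *ₚ det (suc s) (companion s (λ j → v (suc j))))
            (neg-cong (*-congˡ c (det-cong (suc s) (λ i k → ≡⇒≋ (minor₁-bordered s a c v i k))))))

det-corner : ∀ s v → det (suc s) (bordered s [] minusOne v) ≋ v zero
det-corner zero v = det-bordered-base [] minusOne v
det-corner (suc s) v =
  ≋-trans (det-bordered-step s [] minusOne v)
    (≋-trans (sub-minusOne* [] corner) (det-corner s (λ j → v (punchIn (suc zero) j))))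
  where
  corner = det (suc s) (bordered s [] minusOne (λ j → v (punchIn (suc zero) j)))

horner : ∀ s → (Fin (suc s) → Poly) → Poly
horner zero v = v zero
horner (suc s) v = (X *ₚ horner s (λ j → v (suc j))) +ₚ v zero

det-companion : ∀ s v → det (suc s) (companion s v) ≋ horner s v
det-companion zero v = det-bordered-base X minusOne v
det-companion (suc s) v = begin
  det (suc (suc s)) (companion (suc s) v)                     ≈⟨ det-bordered-step s X minusOne v ⟩
  (X *ₚ det (suc s) (companion s v₊)) -ₚ (minusOne *ₚ corner) ≈⟨ sub-minusOne* (X *ₚ det (suc s) (companion s v₊)) corner ⟩
  (X *ₚ det (suc s) (companion s v₊)) +ₚ corner
    ≈⟨ +-cong (*-congˡ X (det-companion s v₊)) (det-corner s (λ j → v (punchIn (suc zero) j))) ⟩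
  (X *ₚ horner s v₊) +ₚ v zero                                ∎
  where
  open ≋-Reasoning
  v₊ = λ j → v (suc j)
  corner = det (suc s) (bordered s [] minusOne (λ j → v (punchIn (suc zero) j)))

horner-coeff : ∀ s (v : Fin (suc s) → Poly) (c : ℕ → ℤ) →
  (∀ j → toℕ j < s → v j ≋ constₚ (c (toℕ j))) →
  v (fromℕ s) ≋ X +ₚ constₚ (c s) →
  (∀ k → s < k → c k ≡ + 0) →
  ∀ k → coeff (horner s v) k ≡ coeff (Xpow (suc s)) k ℤ.+ c k
horner-coeff zero v c low top above k =
  trans (at top k) (trans (coeff-+ X (constₚ (c 0)) k) (cong (λ z → coeff X k ℤ.+ z) (constTerm k)))
  where
  constTerm : ∀ k → coeff (constₚ (c 0)) k ≡ c k
  constTerm zero = refl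
  constTerm (suc k) = sym (above (suc k) (s≤s z≤n))
horner-coeff (suc s) v c low top above zero = begin
  coeff (X *ₚ horner s (λ j → v (suc j)) +ₚ v zero) 0             ≡⟨ coeff-+ (X *ₚ horner s (λ j → v (suc j))) (v zero) 0 ⟩
  coeff (X *ₚ horner s (λ j → v (suc j))) 0 ℤ.+ coeff (v zero) 0
    ≡⟨ cong₂ ℤ._+_ (coeff-X*-zero (horner s (λ j → v (suc j)))) (at (low zero (s≤s z≤n)) 0) ⟩
  + 0 ℤ.+ c 0                                                      ∎
  where open ≡-Reasoning
horner-coeff (suc s) v c low top above (suc k) = begin
  coeff (X *ₚ horner s (λ j → v (suc j)) +ₚ v zero) (suc k)       ≡⟨ coeff-+ (X *ₚ horner s (λ j → v (suc j))) (v zero) (suc k) ⟩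
  coeff (X *ₚ horner s (λ j → v (suc j))) (suc k) ℤ.+ coeff (v zero) (suc k)
    ≡⟨ cong₂ ℤ._+_ (coeff-X*-suc (horner s (λ j → v (suc j))) k) (at (low zero (s≤s z≤n)) (suc k)) ⟩
  coeff (horner s (λ j → v (suc j))) k ℤ.+ + 0                     ≡⟨ ℤP.+-identityʳ _ ⟩
  coeff (horner s (λ j → v (suc j))) k
    ≡⟨ horner-coeff s (λ j → v (suc j)) (λ k → c (suc k))
         (λ j j<s → low (suc j) (s≤s j<s)) top (λ k s<k → above (suc k) (s≤s s<k)) k ⟩
  coeff (Xpow (suc (suc s))) (suc k) ℤ.+ c (suc k)                 ∎
  where open ≡-Reasoning

-- (5) Arc counts of DC_n.

count-here : ∀ e es → count e (e ∷ es) ≡ suc (count e es)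
count-here (a , b) es with a ≟ℕ a | b ≟ℕ b
... | yes _ | yes _ = refl
... | no a≢a | _ = ⊥-elim (a≢a refl)
... | yes _ | no b≢b = ⊥-elim (b≢b refl)

count-skip : ∀ {e e'} es → e ≢ e' → count e (e' ∷ es) ≡ count e es
count-skip {a , b} {c , d} es e≢e' with a ≟ℕ c | b ≟ℕ d
... | yes refl | yes refl = ⊥-elim (e≢e' refl)
... | yes _ | no _ = refl
... | no _ | _ = refl

count-++ : ∀ e xs ys → count e (xs ++ ys) ≡ count e xs ℕ.+ count e ys
count-++ e [] ys = refl
count-++ (a , b) ((c , d) ∷ xs) ys with a ≟ℕ c | b ≟ℕ d
... | yes _ | yes _ = cong suc (count-++ (a , b) xs ys)
... | yes _ | no _ = count-++ (a , b) xs ys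
... | no _ | _ = count-++ (a , b) xs ys

pathArc : ℕ → ℕ × ℕ
pathArc t = (suc t , suc (suc t))

spokes : ℕ → List ℕ → List (ℕ × ℕ)
spokes n ms = map (λ m → (n , suc m)) ms

pathCount-other : ∀ {r b} ts → b ≢ suc (suc r) → count (suc r , b) (map pathArc ts) ≡ 0
pathCount-other [] b≢ = refl
pathCount-other (t ∷ ts) b≢ =
  trans (count-skip _ (λ eq → b≢ (trans (cong proj₂ eq)
                                         (cong (λ u → suc (suc u)) (ℕP.suc-injective (sym (cong proj₁ eq)))))))
        (pathCount-other ts b≢)

pathCount-notIn : ∀ {r b} ts → All (_≢ r) ts → count (suc r , b) (map pathArc ts) ≡ 0
pathCount-notIn [] [] = refl
pathCount-notIn (t ∷ ts) (t≢r ∷ ts≢r) =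
  trans (count-skip _ (λ eq → t≢r (ℕP.suc-injective (sym (cong proj₁ eq))))) (pathCount-notIn ts ts≢r)

pathCount-upTo : ∀ m r → r < m → count (suc r , suc (suc r)) (map pathArc (upTo m)) ≡ 1
pathCount-upTo (suc m) r (s≤s r≤m) = trans snoc (lastStep (r ≟ℕ m))
  where
  e = (suc r , suc (suc r))
  snoc : count e (map pathArc (upTo (suc m))) ≡ count e (map pathArc (upTo m)) ℕ.+ count e [ pathArc m ]
  snoc = trans (cong (λ ts → count e (map pathArc ts)) (sym (upTo-∷ʳ m)))
               (trans (cong (count e) (map-++ pathArc (upTo m) [ m ])) (count-++ e (map pathArc (upTo m)) [ pathArc m ]))
  lastStep : Dec (r ≡ m) → count e (map pathArc (upTo m)) ℕ.+ count e [ pathArc m ] ≡ 1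
  lastStep (yes refl) =
    cong₂ ℕ._+_ (pathCount-notIn (upTo r) (All.map ℕP.<⇒≢ (all-upTo r))) (count-here e [])
  lastStep (no r≢m) =
    cong₂ ℕ._+_ (pathCount-upTo m r (ℕP.≤∧≢⇒< r≤m r≢m))
                (count-skip [] (λ eq → r≢m (ℕP.suc-injective (cong proj₁ eq))))

spokeCount-other : ∀ {a b} n ms → a ≢ n → count (a , b) (spokes n ms) ≡ 0
spokeCount-other n [] a≢n = refl
spokeCount-other n (m ∷ ms) a≢n = trans (count-skip _ (λ eq → a≢n (cong proj₁ eq))) (spokeCount-other n ms a≢n)

spokeCount : ∀ n k ms → + count (n , suc k) (spokes n ms) ≡ coeff (sumₚ (map Xpow ms)) k
spokeCount n k [] = refl
spokeCount n k (m ∷ ms) with k ≟ℕ m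
... | yes refl = begin
  + count (n , suc k) ((n , suc k) ∷ spokes n ms)         ≡⟨ cong +_ (count-here _ (spokes n ms)) ⟩
  + 1 ℤ.+ + count (n , suc k) (spokes n ms)               ≡⟨ cong₂ ℤ._+_ (sym (coeff-Xpow-same k)) (spokeCount n k ms) ⟩
  coeff (Xpow k) k ℤ.+ coeff (sumₚ (map Xpow ms)) k       ≡⟨ coeff-+ (Xpow k) _ k ⟨
  coeff (Xpow k +ₚ sumₚ (map Xpow ms)) k                  ∎
  where open ≡-Reasoning
... | no k≢m = begin
  + count (n , suc k) ((n , suc m) ∷ spokes n ms)
    ≡⟨ cong +_ (count-skip (spokes n ms) (λ eq → k≢m (ℕP.suc-injective (cong proj₂ eq)))) ⟩
  + count (n , suc k) (spokes n ms)                       ≡⟨ spokeCount n k ms ⟩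
  coeff (sumₚ (map Xpow ms)) k                            ≡⟨ ℤP.+-identityˡ _ ⟨
  + 0 ℤ.+ coeff (sumₚ (map Xpow ms)) k                    ≡⟨ cong (ℤ._+ _) (coeff-Xpow-other m k k≢m) ⟨
  coeff (Xpow m) k ℤ.+ coeff (sumₚ (map Xpow ms)) k       ≡⟨ coeff-+ (Xpow m) _ k ⟨
  coeff (Xpow m +ₚ sumₚ (map Xpow ms)) k                  ∎
  where open ≡-Reasoning

dc-innerRow : ∀ s ns r b → r < s → count (suc r , b) (DCarcs (suc s) ns) ≡ count (suc r , b) (map pathArc (upTo s))
dc-innerRow s ns r b r<s =
  trans (count-++ (suc r , b) (map pathArc (upTo s)) ((suc s , 1) ∷ spokes (suc s) ns))
        (trans (cong (count (suc r , b) (map pathArc (upTo s)) ℕ.+_)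
                     (trans (count-skip _ (λ eq → r≢s (cong proj₁ eq))) (spokeCount-other (suc s) ns r≢s)))
               (ℕP.+-identityʳ _))
  where
  r≢s : suc r ≢ suc s
  r≢s eq = ℕP.<-irrefl (ℕP.suc-injective eq) r<s

-- The out-neighbours of vertex n, encoded as the polynomial 1 + Σ_t x^{n_t}.
outPoly : List ℕ → Poly
outPoly ns = constₚ (+ 1) +ₚ sumₚ (map Xpow ns)

dc-lastVertex : ∀ s ns k → + count (suc s , suc k) (DCarcs (suc s) ns) ≡ coeff (outPoly ns) k
dc-lastVertex s ns k = begin
  + count e (map pathArc (upTo s) ++ rest)                       ≡⟨ cong +_ (count-++ e (map pathArc (upTo s)) rest) ⟩
  + (count e (map pathArc (upTo s)) ℕ.+ count e rest)
    ≡⟨ cong (λ z → + (z ℕ.+ count e rest)) (pathCount-notIn (upTo s) (All.map ℕP.<⇒≢ (all-upTo s))) ⟩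
  + count e rest                                                 ≡⟨ spokesAndLoop k ⟩
  coeff (outPoly ns) k                                           ∎
  where
  open ≡-Reasoning
  e = (suc s , suc k)
  rest = (suc s , 1) ∷ spokes (suc s) ns
  spokesAndLoop : ∀ k → + count (suc s , suc k) ((suc s , 1) ∷ spokes (suc s) ns) ≡ coeff (outPoly ns) k
  spokesAndLoop zero =
    trans (cong +_ (count-here _ (spokes (suc s) ns)))
          (trans (cong (λ z → + 1 ℤ.+ z) (spokeCount (suc s) 0 ns)) (sym (coeff-+ (constₚ (+ 1)) (sumₚ (map Xpow ns)) 0)))
  spokesAndLoop (suc k) =
    trans (cong +_ (count-skip {e' = (suc s , 1)} (spokes (suc s) ns) (λ eq → ℕP.0≢1+n (sym (ℕP.suc-injective (cong proj₂ eq))))))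
          (trans (spokeCount (suc s) (suc k) ns)
                 (trans (sym (ℤP.+-identityˡ _)) (sym (coeff-+ (constₚ (+ 1)) (sumₚ (map Xpow ns)) (suc k)))))

outPoly-above : ∀ s ns → All (λ m → 0 < m × m < suc s) ns → ∀ k → s < k → coeff (outPoly ns) k ≡ + 0
outPoly-above s ns bounds (suc k) (s≤s s≤k) =
  trans (coeff-+ (constₚ (+ 1)) (sumₚ (map Xpow ns)) (suc k))
        (trans (ℤP.+-identityˡ _)
               (coeff-sumXpow-above ns (suc k) (All.map (λ b → ℕP.<-≤-trans (proj₂ b) (s≤s s≤k)) bounds)))

-- (6) xI - A is a companion matrix.

charEntry : ℤ → ℕ → Poly
charEntry d m = (constₚ d *ₚ X) -ₚ constₚ (+ m)

charMatrix : (n : ℕ) → List (ℕ × ℕ) → Fin n → Fin n → Poly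
charMatrix n arcs i j = charEntry (δ i j) (adj n arcs i j)

coeff-charEntry : ∀ d m k → coeff (charEntry d m) k ≡ d ℤ.* coeff X k ℤ.+ coeff (constₚ (ℤ.- (+ m))) k
coeff-charEntry d m k =
  trans (coeff-+ (constₚ d *ₚ X) (constₚ (ℤ.- (+ m))) k) (cong (ℤ._+ coeff (constₚ (ℤ.- (+ m))) k) (coeff-const* d X k))

charEntry-diag : ∀ m → charEntry (+ 1) m ≋ X +ₚ constₚ (ℤ.- (+ m))
charEntry-diag m = coeffwise λ k →
  trans (coeff-charEntry (+ 1) m k)
        (trans (cong (ℤ._+ coeff (constₚ (ℤ.- (+ m))) k) (ℤP.*-identityˡ (coeff X k)))
               (sym (coeff-+ X (constₚ (ℤ.- (+ m))) k)))

charEntry-off : ∀ m → charEntry (+ 0) m ≋ constₚ (ℤ.- (+ m))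
charEntry-off m = coeffwise λ k →
  trans (coeff-charEntry (+ 0) m k)
        (trans (cong (ℤ._+ coeff (constₚ (ℤ.- (+ m))) k) (ℤP.*-zeroˡ (coeff X k))) (ℤP.+-identityˡ _))

δ-diag : ∀ {n} (i j : Fin n) → toℕ i ≡ toℕ j → δ i j ≡ + 1
δ-diag i j i≡j with toℕ i ≟ℕ toℕ j
... | yes _ = refl
... | no i≢j = ⊥-elim (i≢j i≡j)

δ-off : ∀ {n} (i j : Fin n) → toℕ i ≢ toℕ j → δ i j ≡ + 0
δ-off i j i≢j with toℕ i ≟ℕ toℕ j
... | yes i≡j = ⊥-elim (i≢j i≡j)
... | no _ = refl

pathRow : ℕ → ℕ → Poly
pathRow zero zero = X
pathRow zero (suc zero) = minusOne
pathRow zero (suc (suc _)) = []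
pathRow (suc r) zero = []
pathRow (suc r) (suc c) = pathRow r c

pathRow-diag : ∀ r → pathRow r r ≡ X
pathRow-diag zero = refl
pathRow-diag (suc r) = pathRow-diag r

pathRow-next : ∀ r → pathRow r (suc r) ≡ minusOne
pathRow-next zero = refl
pathRow-next (suc r) = pathRow-next r

pathRow-other : ∀ r c → c ≢ r → c ≢ suc r → pathRow r c ≡ []
pathRow-other zero zero c≢r _ = ⊥-elim (c≢r refl)
pathRow-other zero (suc zero) _ c≢r+1 = ⊥-elim (c≢r+1 refl)
pathRow-other zero (suc (suc c)) _ _ = refl
pathRow-other (suc r) zero _ _ = refl
pathRow-other (suc r) (suc c) c≢r c≢r+1 = pathRow-other r c (λ e → c≢r (cong suc e)) (λ e → c≢r+1 (cong suc e))

companion-shape : ∀ s (G : Fin (suc s) → Fin (suc s) → Poly) →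
  (∀ i j → toℕ i < s → G i j ≋ pathRow (toℕ i) (toℕ j)) →
  ∀ i j → G i j ≋ companion s (G (fromℕ s)) i j
companion-shape zero G rows zero j = ≋-refl
companion-shape (suc s) G rows zero zero = rows zero zero (s≤s z≤n)
companion-shape (suc s) G rows zero (suc zero) = rows zero (suc zero) (s≤s z≤n)
companion-shape (suc s) G rows zero (suc (suc j)) = rows zero (suc (suc j)) (s≤s z≤n)
companion-shape (suc s) G rows (suc i) zero =
  column₀ s (λ i → G (suc i) zero) (λ i i<s → rows (suc i) zero (s≤s i<s)) i
  where
  column₀ : ∀ s (col : Fin (suc s) → Poly) → (∀ i → toℕ i < s → col i ≋ []) →
    ∀ i → col i ≋ lastOnly i (col (fromℕ s))
  column₀ zero col above zero = ≋-refl
  column₀ (suc s) col above zero = above zero (s≤s z≤n)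
  column₀ (suc s) col above (suc i) = column₀ s (λ i → col (suc i)) (λ i i<s → above (suc i) (s≤s i<s)) i
companion-shape (suc s) G rows (suc i) (suc k) =
  companion-shape s (λ i k → G (suc i) (suc k)) (λ i j i<s → rows (suc i) (suc j) (s≤s i<s)) i k

dc-innerRows : ∀ s ns (i j : Fin (suc s)) → toℕ i < s →
  charMatrix (suc s) (DCarcs (suc s) ns) i j ≋ pathRow (toℕ i) (toℕ j)
dc-innerRows s ns i j i<s with toℕ j ≟ℕ toℕ i | toℕ j ≟ℕ suc (toℕ i)
... | yes j≡i | _
  rewrite δ-diag i j (sym j≡i)
        | dc-innerRow s ns (toℕ i) (suc (toℕ j)) i<s
        | pathCount-other (upTo s) (λ eq → ℕP.<-irrefl (trans (sym j≡i) (ℕP.suc-injective eq)) ℕP.≤-refl)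
        | j≡i | pathRow-diag (toℕ i) = charEntry-diag 0
... | no j≢i | yes j≡i+1
  rewrite δ-off i j (λ i≡j → j≢i (sym i≡j))
        | dc-innerRow s ns (toℕ i) (suc (toℕ j)) i<s
        | j≡i+1 | pathCount-upTo s (toℕ i) i<s | pathRow-next (toℕ i) = charEntry-off 1
... | no j≢i | no j≢i+1
  rewrite δ-off i j (λ i≡j → j≢i (sym i≡j))
        | dc-innerRow s ns (toℕ i) (suc (toℕ j)) i<s
        | pathCount-other {toℕ i} (upTo s) (λ eq → j≢i+1 (ℕP.suc-injective eq))
        | pathRow-other (toℕ i) (toℕ j) j≢i j≢i+1 = ≋-trans (charEntry-off 0) constₚ-zero

dc-lastRowCount : ∀ s ns (j : Fin (suc s)) →
  + adj (suc s) (DCarcs (suc s) ns) (fromℕ s) j ≡ coeff (outPoly ns) (toℕ j)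
dc-lastRowCount s ns j =
  trans (cong (λ a → + count (suc a , suc (toℕ j)) (DCarcs (suc s) ns)) (toℕ-fromℕ s))
        (dc-lastVertex s ns (toℕ j))

dc-lastRow-low : ∀ s ns (j : Fin (suc s)) → toℕ j < s →
  charMatrix (suc s) (DCarcs (suc s) ns) (fromℕ s) j ≋ constₚ (ℤ.- coeff (outPoly ns) (toℕ j))
dc-lastRow-low s ns j j<s = begin
  charEntry (δ (fromℕ s) j) a       ≡⟨ cong (λ d → charEntry d a) (δ-off (fromℕ s) j last≢j) ⟩
  charEntry (+ 0) a                 ≈⟨ charEntry-off a ⟩
  constₚ (ℤ.- (+ a))                ≡⟨ cong (λ z → constₚ (ℤ.- z)) (dc-lastRowCount s ns j) ⟩
  constₚ (ℤ.- coeff (outPoly ns) (toℕ j)) ∎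
  where
  open ≋-Reasoning
  a = adj (suc s) (DCarcs (suc s) ns) (fromℕ s) j
  last≢j : toℕ (fromℕ s) ≢ toℕ j
  last≢j eq = ℕP.<-irrefl (trans (sym eq) (toℕ-fromℕ s)) j<s

dc-lastRow-top : ∀ s ns →
  charMatrix (suc s) (DCarcs (suc s) ns) (fromℕ s) (fromℕ s) ≋ X +ₚ constₚ (ℤ.- coeff (outPoly ns) s)
dc-lastRow-top s ns = begin
  charEntry (δ (fromℕ s) (fromℕ s)) a   ≡⟨ cong (λ d → charEntry d a) (δ-diag (fromℕ s) (fromℕ s) refl) ⟩
  charEntry (+ 1) a                     ≈⟨ charEntry-diag a ⟩
  X +ₚ constₚ (ℤ.- (+ a))
    ≡⟨ cong (λ z → X +ₚ constₚ (ℤ.- z))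
            (trans (dc-lastRowCount s ns (fromℕ s)) (cong (coeff (outPoly ns)) (toℕ-fromℕ s))) ⟩
  X +ₚ constₚ (ℤ.- coeff (outPoly ns) s) ∎
  where
  open ≋-Reasoning
  a = adj (suc s) (DCarcs (suc s) ns) (fromℕ s) (fromℕ s)

target-coeff : ∀ n ns k →
  coeff (Xpow n) k ℤ.+ ℤ.- coeff (outPoly ns) k ≡ coeff (Xpow n -ₚ sumₚ (map Xpow ns) -ₚ constₚ (+ 1)) k
target-coeff n ns k = begin
  x ℤ.+ ℤ.- coeff (outPoly ns) k             ≡⟨ cong (λ z → x ℤ.+ ℤ.- z) (coeff-+ (constₚ (+ 1)) (sumₚ (map Xpow ns)) k) ⟩
  x ℤ.+ ℤ.- (o ℤ.+ σ)                        ≡⟨ rearrange x o σ ⟩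
  (x ℤ.- σ) ℤ.- o                            ≡⟨ cong (ℤ._- o) (coeff-- (Xpow n) _ k) ⟨
  coeff (Xpow n -ₚ sumₚ (map Xpow ns)) k ℤ.- o ≡⟨ coeff-- (Xpow n -ₚ sumₚ (map Xpow ns)) _ k ⟨
  coeff (Xpow n -ₚ sumₚ (map Xpow ns) -ₚ constₚ (+ 1)) k ∎
  where
  open ≡-Reasoning
  x = coeff (Xpow n) k
  o = coeff (constₚ (+ 1)) k
  σ = coeff (sumₚ (map Xpow ns)) k
  rearrange : ∀ x o σ → x ℤ.+ ℤ.- (o ℤ.+ σ) ≡ (x ℤ.- σ) ℤ.- o
  rearrange = solve-∀

mainTheorem7 : (n : ℕ) → 3 ≤ n → (ns : List ℕ) →
    Linked _>_ ns → All (λ m → 0 < m × m < n) ns →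
    charPoly n (DCarcs n ns) ≈ₚ (Xpow n -ₚ sumₚ (map Xpow ns) -ₚ constₚ (+ 1))
mainTheorem7 (suc s) _ ns _ bounds k = begin
  coeff (det (suc s) M) k                   ≡⟨ at (det-cong (suc s) (companion-shape s M (dc-innerRows s ns))) k ⟩
  coeff (det (suc s) (companion s v)) k     ≡⟨ at (det-companion s v) k ⟩
  coeff (horner s v) k
    ≡⟨ horner-coeff s v c (dc-lastRow-low s ns) (dc-lastRow-top s ns)
                    (λ k s<k → cong ℤ.-_ (outPoly-above s ns bounds k s<k)) k ⟩
  coeff (Xpow (suc s)) k ℤ.+ c k            ≡⟨ target-coeff (suc s) ns k ⟩
  coeff (Xpow (suc s) -ₚ sumₚ (map Xpow ns) -ₚ constₚ (+ 1)) k ∎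
  where
  open ≡-Reasoning
  M = charMatrix (suc s) (DCarcs (suc s) ns)
  v = M (fromℕ s)
  c : ℕ → ℤ
  c k = ℤ.- coeff (outPoly ns) k
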